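{- Let $n,a\in\mathbb{N}$. Then $\operatorname{lev}_n(a)=\min\{k\in\mathbb{N}_0: {}^{k+1}a\equiv {}^k a \pmod n\}$.
   Context: Tetration: ${}^0a=1$, ${}^ka=a^{({}^{k-1}a)}$ for $k\in\mathbb{N}$. For $n,a\in\mathbb{N}$, $\operatorname{lev}_n(a)$ (the level of $a$ modulo $n$) is the length of the preperiod of the (eventually constant) sequence $({}^ka\bmod n)_{k\ge0}$, i.e. the least $t\ge0$ such that ${}^ka\equiv{}^ta\pmod n$ for all $k\ge t$. -}

module Defs where

open import Data.Nat using (ℕ; zero; suc; _^_; _≤_; _<_; NonZero)
open import Data.Nat.DivMod using (_%_)
open import Data.Product using (_×_)
open import Relation.Binary.PropositionalEquality using (_≡_)
open import Relation.Nullary using (¬_)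

tet : ℕ → ℕ → ℕ
tet a zero    = 1
tet a (suc k) = a ^ tet a k

_≡_[mod_] : ℕ → ℕ → (n : ℕ) → .{{NonZero n}} → Set
x ≡ y [mod n ] = x % n ≡ y % n

IsLeast : (ℕ → Set) → ℕ → Set
IsLeast P t = P t × (∀ s → s < t → ¬ P s)

StableFrom : (n a : ℕ) → .{{NonZero n}} → ℕ → Set
StableFrom n a t = ∀ k → t ≤ k → tet a k ≡ tet a t [mod n ]

IsLev : (n a : ℕ) → .{{NonZero n}} → ℕ → Set
IsLev n a = IsLeast (StableFrom n a)

OneStep : (n a : ℕ) → .{{NonZero n}} → ℕ → Set
OneStep n a k = tet a (suc k) ≡ tet a k [mod n ]

-- Since a ≥ 1, the tower ᵏa is nondecreasing and its increments Δₖ = ᵏ⁺¹a − ᵏa divide one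
-- another: Δₖ₊₁ = a^(ᵏa) (a^Δₖ − 1) and x − 1 ∣ x^m − 1. Hence once n ∣ Δₜ, n divides every later
-- increment and the sequence is constant modulo n from t on; so "stable from t" and "one step
-- from t" are the same property of t, and their least elements coincide.
module Submission where

open import Defs
open import Data.Nat using (ℕ; NonZero; zero; suc; _+_; _*_; _∸_; _^_; _≤_; _≤′_; ≤′-refl; ≤′-step; _%_; _/_)
open import Data.Nat.Properties
open import Data.Nat.DivMod using (m≡m%n+[m/n]*n; %-remove-+ʳ)
open import Data.Nat.Divisibility
open import Data.Product using (_,_)
open import Function.Bundles using (_⇔_; mk⇔; Equivalence)
open import Relation.Binary.PropositionalEquality

m∸1∣m^n∸1 : ∀ m n → m ∸ 1 ∣ m ^ n ∸ 1
m∸1∣m^n∸1 zero    zero    = ∣-refl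
m∸1∣m^n∸1 zero    (suc n) = ∣-refl
m∸1∣m^n∸1 (suc m) zero    = m ∣0
m∸1∣m^n∸1 (suc m) (suc n) =
  subst (m ∣_) (sym (+-∸-comm (m * suc m ^ n) (m^n>0 (suc m) n)))
    (∣m∣n⇒∣m+n (m∸1∣m^n∸1 (suc m) n) (m∣m*n _))

m^n∸1∣m^o∸1 : ∀ m {n o} → n ∣ o → m ^ n ∸ 1 ∣ m ^ o ∸ 1
m^n∸1∣m^o∸1 m {n} (divides k refl) =
  subst (λ x → m ^ n ∸ 1 ∣ x ∸ 1) (trans (^-*-assoc m n k) (cong (m ^_) (*-comm n k)))
    (m∸1∣m^n∸1 (m ^ n) k)

m^n∣m^o : ∀ m {n o} → n ≤ o → m ^ n ∣ m ^ o
m^n∣m^o m {n} {o} n≤o =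
  subst (m ^ n ∣_) (trans (sym (^-distribˡ-+-* m n (o ∸ n))) (cong (m ^_) (m+[n∸m]≡n n≤o)))
    (m∣m*n _)

m^[n+o]∸m^n≡m^n*[m^o∸1] : ∀ m n o → m ^ (n + o) ∸ m ^ n ≡ m ^ n * (m ^ o ∸ 1)
m^[n+o]∸m^n≡m^n*[m^o∸1] m n o = begin
  m ^ (n + o) ∸ m ^ n         ≡⟨ cong₂ _∸_ (^-distribˡ-+-* m n o) (sym (*-identityʳ (m ^ n))) ⟩
  m ^ n * m ^ o ∸ m ^ n * 1   ≡⟨ sym (*-distribˡ-∸ (m ^ n) (m ^ o) 1) ⟩
  m ^ n * (m ^ o ∸ 1)         ∎
  where open ≡-Reasoning

d∣m∸n⇒m%d≡n%d : ∀ {m n} d .{{_ : NonZero d}} → n ≤ m → d ∣ m ∸ n → m % d ≡ n % d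
d∣m∸n⇒m%d≡n%d {m} {n} d n≤m d∣m∸n =
  trans (cong (_% d) (sym (m+[n∸m]≡n n≤m))) (%-remove-+ʳ n d∣m∸n)

m%d≡n%d⇒d∣m∸n : ∀ {m n} d .{{_ : NonZero d}} → m % d ≡ n % d → d ∣ m ∸ n
m%d≡n%d⇒d∣m∸n {m} {n} d eq = divides (m / d ∸ n / d) (begin
  m ∸ n                                       ≡⟨ cong₂ _∸_ (m≡m%n+[m/n]*n m d) (m≡m%n+[m/n]*n n d) ⟩
  (m % d + m / d * d) ∸ (n % d + n / d * d)   ≡⟨ cong (λ r → (r + m / d * d) ∸ (n % d + n / d * d)) eq ⟩
  (n % d + m / d * d) ∸ (n % d + n / d * d)   ≡⟨ [m+n]∸[m+o]≡n∸o (n % d) _ _ ⟩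
  m / d * d ∸ n / d * d                       ≡⟨ sym (*-distribʳ-∸ d (m / d) (n / d)) ⟩
  (m / d ∸ n / d) * d                         ∎)
  where open ≡-Reasoning

Δ : (ℕ → ℕ) → ℕ → ℕ
Δ f k = f (suc k) ∸ f k

module _ (f : ℕ → ℕ) (f-mono : ∀ k → f k ≤ f (suc k)) (Δ∣Δ : ∀ k → Δ f k ∣ Δ f (suc k))
         (d : ℕ) .{{_ : NonZero d}} where

  ∣Δ-upward : ∀ {t k} → t ≤′ k → d ∣ Δ f t → d ∣ Δ f k
  ∣Δ-upward ≤′-refl        d∣Δₜ = d∣Δₜ
  ∣Δ-upward (≤′-step t≤′k) d∣Δₜ = ∣-trans (∣Δ-upward t≤′k d∣Δₜ) (Δ∣Δ _)

  ∣Δ⇒constant-mod : ∀ {t k} → t ≤′ k → d ∣ Δ f t → f k % d ≡ f t % d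
  ∣Δ⇒constant-mod ≤′-refl            d∣Δₜ = refl
  ∣Δ⇒constant-mod (≤′-step {k} t≤′k) d∣Δₜ =
    trans (d∣m∸n⇒m%d≡n%d d (f-mono k) (∣Δ-upward t≤′k d∣Δₜ)) (∣Δ⇒constant-mod t≤′k d∣Δₜ)

IsLeast-resp-⇔ : ∀ {P Q : ℕ → Set} → (∀ s → P s ⇔ Q s) → ∀ t → IsLeast P t ⇔ IsLeast Q t
IsLeast-resp-⇔ P⇔Q t = mk⇔
  (λ (Pt , least) → to (P⇔Q t) Pt , λ s s<t Qs → least s s<t (from (P⇔Q s) Qs))
  (λ (Qt , least) → from (P⇔Q t) Qt , λ s s<t Ps → least s s<t (to (P⇔Q s) Ps))
  where open Equivalence

module _ (a : ℕ) .{{_ : NonZero a}} where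

  tet-mono : ∀ k → tet a k ≤ tet a (suc k)
  tet-mono zero    = m^n>0 a 1
  tet-mono (suc k) = ^-monoʳ-≤ a (tet-mono k)

  Δtet-suc : ∀ k → Δ (tet a) (suc k) ≡ a ^ tet a k * (a ^ Δ (tet a) k ∸ 1)
  Δtet-suc k = begin
    a ^ tet a (suc k) ∸ a ^ tet a k                 ≡⟨ cong (λ x → a ^ x ∸ a ^ tet a k) (sym (m+[n∸m]≡n (tet-mono k))) ⟩
    a ^ (tet a k + Δ (tet a) k) ∸ a ^ tet a k       ≡⟨ m^[n+o]∸m^n≡m^n*[m^o∸1] a (tet a k) (Δ (tet a) k) ⟩
    a ^ tet a k * (a ^ Δ (tet a) k ∸ 1)             ∎
    where open ≡-Reasoning

  Δtet∣Δtet : ∀ k → Δ (tet a) k ∣ Δ (tet a) (suc k)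
  -- Δ₀ is definitionally a ^ 1 ∸ 1.
  Δtet∣Δtet zero    = subst (a ^ 1 ∸ 1 ∣_) (sym (Δtet-suc zero))
    (∣n⇒∣m*n (a ^ 1) (m^n∸1∣m^o∸1 a (1∣ Δ (tet a) 0)))
  Δtet∣Δtet (suc k) = subst₂ _∣_ (sym (Δtet-suc k)) (sym (Δtet-suc (suc k)))
    (*-pres-∣ (m^n∣m^o a (tet-mono k)) (m^n∸1∣m^o∸1 a (Δtet∣Δtet k)))

  StableFrom⇔OneStep : ∀ n .{{_ : NonZero n}} t → StableFrom n a t ⇔ OneStep n a t
  StableFrom⇔OneStep n t = mk⇔
    (λ stable → stable (suc t) (n≤1+n t))
    (λ step k t≤k → ∣Δ⇒constant-mod (tet a) tet-mono Δtet∣Δtet n (≤⇒≤′ t≤k) (m%d≡n%d⇒d∣m∸n n step))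

lemma5p8 : (n a : ℕ) → .{{_ : NonZero n}} → NonZero a →
    ∀ t → IsLev n a t ⇔ IsLeast (OneStep n a) t
lemma5p8 n a a≢0 = IsLeast-resp-⇔ (StableFrom⇔OneStep a {{a≢0}} n)
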